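{- Let $b$ be a positive integer and $\lambda=(\lambda_1,\dots,\lambda_k)$ a nonempty $b$-regular partition with $k$ nonzero parts. If $b$ divides the hook length $H_{11}$ of the box $(1,1)$, then $$j_1:=|\lambda|-|\lambda^{\mathrm J}|\le\lambda_1-1.$$
   Context: Young diagram conventions: box $(i,j)$ with row $i$, column $1\le j\le\lambda_i$; $H_{11}=\lambda_1+k-1$. The rim of $\lambda$ is the set of boxes $(i,j)\in\lambda$ with $(i+1,j+1)\notin\lambda$. A partition is $b$-regular if no $b$ nonzero parts are equal. The $b$-rim of a $b$-regular $\lambda$: take the first $b$ rim boxes starting from the rightmost box of the first row and moving southwestwards along the rim; if the last box of this piece lies in row $i_0$, start the next piece of $b$ rim boxes at the rightmost box of row $i_0+1$, moving southwestwards; continue until a piece ends in the last row (every piece except possibly the last has $b$ boxes). $\lambda^{\mathrm I}$ is $\lambda$ with its $b$-rim removed, written as $(\mu_1,\dots,\mu_k)$ with some trailing $\mu_i$ possibly $0$, and $\phi(\lambda)=|\lambda|-|\lambda^{\mathrm I}|$. Then $\lambda^{\mathrm J}:=(\mu_1+1,\dots,\mu_{k-1}+1,\mu_k+\delta)$ where $\delta=1$ if $b\mid\phi(\lambda)$ and $\delta=0$ otherwise. -}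

module Defs where

open import Data.Nat using (ℕ; zero; suc; _+_; _∸_; _<_; _≤_; _⊔_; _≟_; _<?_)
open import Data.Product using (_×_; _,_; proj₁)
open import Data.List using (List; []; _∷_; length; map; upTo; concatMap; take; last; filter; _++_)
open import Data.Nat.ListAction using (sum)
open import Data.List.Relation.Unary.All using (All)
open import Data.List.Relation.Unary.Linked using (Linked)
open import Data.Maybe using (Maybe; just; nothing)
open import Data.Nat.Divisibility using (_∣?_)
open import Relation.Nullary using (does)
open import Data.Bool using (if_then_else_)

record IsPartition (λs : List ℕ) : Set where
  field
    decreasing : Linked (λ x y → y ≤ x) λs
    positive   : All (λ x → 0 < x) λs

-- Row length λ_i (rows 1-indexed; λ_i = 0 for i = 0 or i > k).
rowLen : List ℕ → ℕ → ℕ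
rowLen []       _             = 0
rowLen (x ∷ xs) zero          = 0
rowLen (x ∷ xs) (suc zero)    = x
rowLen (x ∷ xs) (suc (suc i)) = rowLen xs (suc i)

IsRegular : ℕ → List ℕ → Set
IsRegular b λs = ∀ v → 0 < v → length (filter (_≟ v) λs) < b

-- Boxes (row , column), 1-indexed.
Box : Set
Box = ℕ × ℕ

-- Rim boxes of row i, i.e. the boxes (i,j) ∈ λ with (i+1,j+1) ∉ λ,
-- equivalently columns j with max 1 λ_{i+1} ≤ j ≤ λ_i, listed from
-- right to left (the order of the southwestward walk along the rim).
rimRow : List ℕ → ℕ → List Box
rimRow λs i with rowLen λs i
... | zero    = []
... | suc m   = map (λ t → (i , suc m ∸ t)) (upTo (suc (suc m) ∸ (1 ⊔ rowLen λs (suc i))))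

rimFrom : List ℕ → ℕ → List Box
rimFrom λs r = concatMap (rimRow λs) (map (r +_) (upTo (suc (length λs) ∸ r)))

-- The pieces of the b-rim starting at row r (fuel bounds the number of pieces).
bRimFrom : ℕ → ℕ → List ℕ → ℕ → List Box
bRimFrom zero     b λs r = []
bRimFrom (suc f)  b λs r with last (take b (rimFrom λs r))
... | nothing        = take b (rimFrom λs r)
... | just (i₀ , _)  = take b (rimFrom λs r) ++
        (if does (i₀ <? length λs) then bRimFrom f b λs (suc i₀) else [])

-- The b-rim of λ (each piece advances at least one row, so k pieces of fuel suffice).
bRim : ℕ → List ℕ → List Box
bRim b λs = bRimFrom (length λs) b λs 1

rimCount : ℕ → List ℕ → ℕ → ℕ
rimCount b λs i = length (filter (λ bx → proj₁ bx ≟ i) (bRim b λs))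

-- λ^I = (μ₁, …, μ_k): λ with its b-rim removed (trailing zeros kept).
partI : ℕ → List ℕ → List ℕ
partI b λs = map (λ i → rowLen λs i ∸ rimCount b λs i) (map suc (upTo (length λs)))

size : List ℕ → ℕ
size = sum

φ : ℕ → List ℕ → ℕ
φ b λs = size λs ∸ size (partI b λs)

addJ : ℕ → List ℕ → List ℕ
addJ δ []           = []
addJ δ (m ∷ [])     = m + δ ∷ []
addJ δ (m ∷ n ∷ ms) = suc m ∷ addJ δ (n ∷ ms)

partJ : ℕ → List ℕ → List ℕ
partJ b λs = addJ (if does (b ∣? φ b λs) then 1 else 0) (partI b λs)

-- Each piece of the b-rim is an initial segment of the rim walked from its
-- starting row; it ends in some row i₀ and the next piece starts at row i₀ + 1.
-- The pieces are therefore disjoint segments of the rim, so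
-- φ(λ) ≤ |b-rim| ≤ |rim| = λ₁ + k − 1 = H₁₁.  Since |λ^J| = |λ^I| + (k − 1) + δ,
-- this gives j₁ ≤ λ₁ − 1 at once when δ = 1; when δ = 0 we have b ∤ φ(λ) but
-- b ∣ H₁₁, so φ(λ) ≠ H₁₁ and the bound improves by one.

module Submission where

open import Defs
open import Data.Nat using (ℕ; _+_; _∸_; _<_)
open import Data.Nat.Divisibility using (_∣_)
open import Data.List using (List; _∷_; length)
open import Data.Integer using (ℤ; +_; _-_; _≤_)

open import Data.Nat as ℕ using (zero; suc; s≤s⁻¹; _≟_; _≤?_; z≤n; s≤s; _⊔_)
open import Data.Nat.Properties
open import Data.Nat.Divisibility using (_∣?_)
open import Data.Nat.ListAction using (sum)
open import Data.List using ([]; map; upTo; applyUpTo; concatMap; take; last; filter; _++_)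
open import Data.List.Properties
  using (length-++; length-map; length-upTo; length-take; map-upTo; map-∘; length-filter; ++-assoc; ++-identityʳ; filter-accept; filter-reject)
open import Data.List.Relation.Unary.All as All using (All; []; _∷_)
open import Data.List.Relation.Unary.All.Properties as All using (last⁺)
open import Data.List.Relation.Unary.Linked using (Linked; _∷_)
open import Data.List.Relation.Unary.AllPairs using (AllPairs; []; _∷_)
import Data.List.Relation.Unary.AllPairs.Properties as AllPairs
open import Data.Bool using (true; false; if_then_else_)
open import Data.Maybe using (just; nothing)
open import Data.Maybe.Relation.Unary.All as Maybe using (drop-just)
open import Data.Product using (_,_; proj₁)
open import Data.Empty using (⊥-elim)
open import Data.Sum using (inj₁; inj₂)
open import Data.Integer using (+≤+)
import Data.Integer.Properties as ℤ
open import Data.Nat.Solver using (module +-*-Solver)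
open +-*-Solver using (solve; _:+_; _:=_; con)
open import Function using (_∘_)
open import Level using (Level)
open import Relation.Binary using (Rel; Reflexive; tri<; tri≈; tri>)
open import Algebra.Properties.CommutativeSemigroup +-commutativeSemigroup using (interchange)
open import Relation.Binary.PropositionalEquality
open import Relation.Nullary using (¬_; does; yes; no)
open import Relation.Nullary.Reflects using (ofʸ)

private variable
  a ℓ : Level
  A   : Set a

last-All : ∀ {P : A → Set ℓ} {xs y} → All P xs → last xs ≡ just y → P y
last-All {P = P} pxs eq = drop-just (subst (Maybe.All P) eq (last⁺ pxs))

AllPairs⇒R-last : ∀ {R : Rel A ℓ} → Reflexive R → ∀ {xs y} → AllPairs R xs → last xs ≡ just y →
                  All (λ x → R x y) xs
AllPairs⇒R-last refl-R {x ∷ []}    _          refl = refl-R ∷ []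
AllPairs⇒R-last refl-R {x ∷ _ ∷ _} (Rx ∷ Rxs) eq   = last-All Rx eq ∷ AllPairs⇒R-last refl-R Rxs eq

length-take-++≤ : ∀ {P : A → Set ℓ} n xs ys → All P (take n (xs ++ ys)) → All (¬_ ∘ P) ys →
                  length (take n (xs ++ ys)) ℕ.≤ length xs
length-take-++≤ zero    xs       ys       _          _          = z≤n
length-take-++≤ (suc n) []       []       _          _          = z≤n
length-take-++≤ (suc n) []       (y ∷ ys) (py ∷ _)   (¬py ∷ _)  = ⊥-elim (¬py py)
length-take-++≤ (suc n) (x ∷ xs) ys       (_ ∷ pxs)  ¬pys       = s≤s (length-take-++≤ n xs ys pxs ¬pys)

length-take≤ : ∀ n (xs : List A) → length (take n xs) ℕ.≤ length xs
length-take≤ n xs = ≤-trans (≤-reflexive (length-take n xs)) (m⊓n≤n n (length xs))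

row : Box → ℕ
row = proj₁

RowSorted : List Box → Set
RowSorted = AllPairs (λ x y → row x ℕ.≤ row y)

sameRow⇒RowSorted : ∀ {i xs} → All (λ x → row x ≡ i) xs → RowSorted xs
sameRow⇒RowSorted []       = []
sameRow⇒RowSorted (e ∷ es) = All.map (λ e′ → ≤-reflexive (trans e (sym e′))) es ∷ sameRow⇒RowSorted es

rimRows : List ℕ → ℕ → ℕ → List Box
rimRows λs r zero    = []
rimRows λs r (suc m) = rimRow λs r ++ rimRows λs (suc r) m

rimFrom≡rimRows : ∀ λs r → rimFrom λs r ≡ rimRows λs r (suc (length λs) ∸ r)
rimFrom≡rimRows λs r = trans (cong (concatMap (rimRow λs)) (map-upTo (λ t → r + t) m)) (go m r (λ t → r + t) (λ _ → refl))
  where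
  m = suc (length λs) ∸ r
  go : ∀ m r (g : ℕ → ℕ) → g ≗ (λ t → r + t) → concatMap (rimRow λs) (applyUpTo g m) ≡ rimRows λs r m
  go zero    r g g≗ = refl
  go (suc m) r g g≗ = cong₂ _++_ (cong (rimRow λs) (trans (g≗ 0) (+-identityʳ r)))
                                 (go m (suc r) (g ∘ suc) (λ t → trans (g≗ (suc t)) (+-suc r t)))

rimRows-++ : ∀ λs r a c → rimRows λs r (a + c) ≡ rimRows λs r a ++ rimRows λs (r + a) c
rimRows-++ λs r zero    c = cong (λ s → rimRows λs s c) (sym (+-identityʳ r))
rimRows-++ λs r (suc a) c = begin
  rimRow λs r ++ rimRows λs (suc r) (a + c)                            ≡⟨ cong (rimRow λs r ++_) (rimRows-++ λs (suc r) a c) ⟩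
  rimRow λs r ++ (rimRows λs (suc r) a ++ rimRows λs (suc r + a) c)    ≡⟨ sym (++-assoc (rimRow λs r) _ _) ⟩
  rimRows λs r (suc a) ++ rimRows λs (suc r + a) c                     ≡⟨ cong (λ s → rimRows λs r (suc a) ++ rimRows λs s c) (sym (+-suc r a)) ⟩
  rimRows λs r (suc a) ++ rimRows λs (r + suc a) c                     ∎
  where open ≡-Reasoning

rimRow-inRow : ∀ λs i → All (λ x → row x ≡ i) (rimRow λs i)
rimRow-inRow λs i with rowLen λs i
... | zero  = []
... | suc _ = inRow _
  where
  inRow : ∀ {h : ℕ → ℕ} ts → All (λ x → row x ≡ i) (map (λ t → (i , h t)) ts)
  inRow []       = []
  inRow (_ ∷ ts) = refl ∷ inRow ts

rimRows-rows≥ : ∀ λs r m → All (λ x → r ℕ.≤ row x) (rimRows λs r m)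
rimRows-rows≥ λs r zero    = []
rimRows-rows≥ λs r (suc m) = All.++⁺ (All.map (≤-reflexive ∘ sym) (rimRow-inRow λs r))
                                     (All.map <⇒≤ (rimRows-rows≥ λs (suc r) m))

rimRows-sorted : ∀ λs r m → RowSorted (rimRows λs r m)
rimRows-sorted λs r zero    = []
rimRows-sorted λs r (suc m) =
  AllPairs.++⁺ (sameRow⇒RowSorted (rimRow-inRow λs r)) (rimRows-sorted λs (suc r) m)
    (All.map (λ e → All.map (≤-trans (≤-reflexive e) ∘ <⇒≤) (rimRows-rows≥ λs (suc r) m)) (rimRow-inRow λs r))

rimFrom-sorted : ∀ λs r → RowSorted (rimFrom λs r)
rimFrom-sorted λs r = subst RowSorted (sym (rimFrom≡rimRows λs r)) (rimRows-sorted λs r (suc (length λs) ∸ r))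

rimFrom-rows≥ : ∀ λs r → All (λ x → r ℕ.≤ row x) (rimFrom λs r)
rimFrom-rows≥ λs r = subst (All _) (sym (rimFrom≡rimRows λs r)) (rimRows-rows≥ λs r (suc (length λs) ∸ r))

rimFrom-split : ∀ λs {r s} → r ℕ.≤ s → s ℕ.≤ suc (length λs) →
                rimFrom λs r ≡ rimRows λs r (s ∸ r) ++ rimFrom λs s
rimFrom-split λs {r} {s} r≤s s≤1+k = begin
  rimFrom λs r                                          ≡⟨ rimFrom≡rimRows λs r ⟩
  rimRows λs r (1+k ∸ r)                                ≡⟨ cong (λ n → rimRows λs r (n ∸ r)) (sym (m+[n∸m]≡n s≤1+k)) ⟩
  rimRows λs r (s + (1+k ∸ s) ∸ r)                      ≡⟨ cong (rimRows λs r) (+-∸-comm (1+k ∸ s) r≤s) ⟩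
  rimRows λs r ((s ∸ r) + (1+k ∸ s))                    ≡⟨ rimRows-++ λs r (s ∸ r) (1+k ∸ s) ⟩
  rimRows λs r (s ∸ r) ++ rimRows λs (r + (s ∸ r)) (1+k ∸ s) ≡⟨ cong (λ t → rimRows λs r (s ∸ r) ++ rimRows λs t (1+k ∸ s)) (m+[n∸m]≡n r≤s) ⟩
  rimRows λs r (s ∸ r) ++ rimRows λs s (1+k ∸ s)        ≡⟨ cong (rimRows λs r (s ∸ r) ++_) (sym (rimFrom≡rimRows λs s)) ⟩
  rimRows λs r (s ∸ r) ++ rimFrom λs s                  ∎
  where
  open ≡-Reasoning
  1+k = suc (length λs)

length-bRimFrom≤ : ∀ f b λs r → length (bRimFrom f b λs r) ℕ.≤ length (rimFrom λs r)
length-bRimFrom≤ zero    b λs r = z≤n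
length-bRimFrom≤ (suc f) b λs r with last (take b (rimFrom λs r)) in last≡
... | nothing = length-take≤ b (rimFrom λs r)
-- `does (i₀ <? length λs)` computes to `i₀ <ᵇ length λs`, so we branch on that.
... | just (i₀ , _) with i₀ ℕ.<ᵇ length λs | <ᵇ-reflects-< i₀ (length λs)
...   | false | _ = ≤-trans (≤-reflexive (cong length (++-identityʳ (take b (rimFrom λs r))))) (length-take≤ b (rimFrom λs r))
...   | true  | ofʸ i₀<k = begin
  length (take b S ++ bRimFrom f b λs (suc i₀))              ≡⟨ length-++ (take b S) ⟩
  length (take b S) + length (bRimFrom f b λs (suc i₀))      ≤⟨ +-mono-≤ piece≤ (length-bRimFrom≤ f b λs (suc i₀)) ⟩
  length (rimRows λs r (suc i₀ ∸ r)) + length (rimFrom λs (suc i₀)) ≡⟨ length-++ (rimRows λs r (suc i₀ ∸ r)) ⟨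
  length (rimRows λs r (suc i₀ ∸ r) ++ rimFrom λs (suc i₀))  ≡⟨ cong length split ⟨
  length S                                                    ∎
  where
  open ≤-Reasoning
  S = rimFrom λs r
  r≤i₀ : r ℕ.≤ i₀
  r≤i₀ = last-All (All.take⁺ b (rimFrom-rows≥ λs r)) last≡
  split : S ≡ rimRows λs r (suc i₀ ∸ r) ++ rimFrom λs (suc i₀)
  split = rimFrom-split λs (m≤n⇒m≤1+n r≤i₀) (m≤n⇒m≤1+n i₀<k)
  piece≤i₀ : All (λ x → row x ℕ.≤ i₀) (take b S)
  piece≤i₀ = AllPairs⇒R-last ≤-refl (AllPairs.take⁺ b (rimFrom-sorted λs r)) last≡
  piece≤ : length (take b S) ℕ.≤ length (rimRows λs r (suc i₀ ∸ r))
  piece≤ = subst (λ T → length (take b T) ℕ.≤ length (rimRows λs r (suc i₀ ∸ r))) (sym split)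
             (length-take-++≤ b (rimRows λs r (suc i₀ ∸ r)) (rimFrom λs (suc i₀))
               (subst (All _ ∘ take b) split piece≤i₀) (All.map <⇒≱ (rimFrom-rows≥ λs (suc i₀))))

rimRowSize : ℕ → ℕ → ℕ
rimRowSize zero    _ = 0
rimRowSize (suc x) y = suc (suc x) ∸ (1 ⊔ y)

rimRowSize≤ : ∀ x y → rimRowSize x y ℕ.≤ x
rimRowSize≤ zero    y = z≤n
rimRowSize≤ (suc x) y = ∸-monoʳ-≤ (suc (suc x)) (m≤m⊔n 1 y)

rimRowSize≤1+x∸y : ∀ x y → rimRowSize x y ℕ.≤ suc x ∸ y
rimRowSize≤1+x∸y zero    y = z≤n
rimRowSize≤1+x∸y (suc x) y = ∸-monoʳ-≤ (suc (suc x)) (m≤n⊔m 1 y)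

length-rimRow : ∀ λs i → length (rimRow λs i) ≡ rimRowSize (rowLen λs i) (rowLen λs (suc i))
length-rimRow λs i with rowLen λs i
... | zero  = refl
... | suc x = trans (length-map _ (upTo (suc (suc x) ∸ (1 ⊔ rowLen λs (suc i))))) (length-upTo _)

length-rimRows-∷ : ∀ x xs r m → length (rimRows (x ∷ xs) (suc (suc r)) m) ≡ length (rimRows xs (suc r) m)
length-rimRows-∷ x xs r zero    = refl
length-rimRows-∷ x xs r (suc m) = begin
  length (rimRow (x ∷ xs) (2 + r) ++ rimRows (x ∷ xs) (3 + r) m) ≡⟨ length-++ (rimRow (x ∷ xs) (2 + r)) ⟩
  length (rimRow (x ∷ xs) (2 + r)) + length (rimRows (x ∷ xs) (3 + r) m)
    ≡⟨ cong₂ _+_ (trans (length-rimRow (x ∷ xs) (2 + r)) (sym (length-rimRow xs (suc r)))) (length-rimRows-∷ x xs (suc r) m) ⟩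
  length (rimRow xs (suc r)) + length (rimRows xs (2 + r) m)     ≡⟨ length-++ (rimRow xs (suc r)) ⟨
  length (rimRows xs (suc r) (suc m))                              ∎
  where open ≡-Reasoning

length-rim≤ : ∀ x xs → Linked (λ a b → b ℕ.≤ a) (x ∷ xs) → length (rimFrom (x ∷ xs) 1) ℕ.≤ x + length xs
length-rim≤ x xs decreasing = subst (ℕ._≤ x + length xs) (cong length (sym (rimFrom≡rimRows (x ∷ xs) 1))) (go x xs decreasing)
  where
  go : ∀ x xs → Linked (λ a b → b ℕ.≤ a) (x ∷ xs) → length (rimRows (x ∷ xs) 1 (suc (length xs))) ℕ.≤ x + length xs
  go x [] _ = begin
    length (rimRow (x ∷ []) 1 ++ []) ≡⟨ cong length (++-identityʳ (rimRow (x ∷ []) 1)) ⟩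
    length (rimRow (x ∷ []) 1)       ≡⟨ length-rimRow (x ∷ []) 1 ⟩
    rimRowSize x 0                   ≤⟨ rimRowSize≤ x 0 ⟩
    x                                ≡⟨ +-identityʳ x ⟨
    x + 0                            ∎
    where open ≤-Reasoning
  go x (y ∷ ys) (y≤x ∷ decreasing) = begin
    length (rimRow (x ∷ y ∷ ys) 1 ++ rimRows (x ∷ y ∷ ys) 2 (suc n))    ≡⟨ length-++ (rimRow (x ∷ y ∷ ys) 1) ⟩
    length (rimRow (x ∷ y ∷ ys) 1) + length (rimRows (x ∷ y ∷ ys) 2 (suc n))
      ≡⟨ cong₂ _+_ (length-rimRow (x ∷ y ∷ ys) 1) (length-rimRows-∷ x (y ∷ ys) 0 (suc n)) ⟩
    rimRowSize x y + length (rimRows (y ∷ ys) 1 (suc n))                 ≤⟨ +-mono-≤ (rimRowSize≤1+x∸y x y) (go y ys decreasing) ⟩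
    (suc x ∸ y) + (y + n)                                                ≡⟨ +-assoc (suc x ∸ y) y n ⟨
    (suc x ∸ y) + y + n                                                  ≡⟨ cong (_+ n) (m∸n+n≡m (m≤n⇒m≤1+n y≤x)) ⟩
    suc x + n                                                            ≡⟨ +-suc x n ⟨
    x + suc n                                                            ∎
    where
    open ≤-Reasoning
    n = length ys

map-rowLen-rows : ∀ λs → map (rowLen λs) (map suc (upTo (length λs))) ≡ λs
map-rowLen-rows λs = trans (sym (map-∘ (upTo (length λs)))) (trans (map-upTo _ (length λs)) (go λs))
  where
  go : ∀ λs → applyUpTo (rowLen λs ∘ suc) (length λs) ≡ λs
  go []       = refl
  go (x ∷ xs) = cong (x ∷_) (go xs)

sum-map≤sum-map-∸+sum-map : ∀ (f g : ℕ → ℕ) is → sum (map f is) ℕ.≤ sum (map (λ i → f i ∸ g i) is) + sum (map g is)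
sum-map≤sum-map-∸+sum-map f g []       = z≤n
sum-map≤sum-map-∸+sum-map f g (i ∷ is) = begin
  f i + sum (map f is)                    ≤⟨ +-mono-≤ (m≤n+m∸n (f i) (g i)) (sum-map≤sum-map-∸+sum-map f g is) ⟩
  (g i + (f i ∸ g i)) + (F∸G + G)         ≡⟨ cong (_+ (F∸G + G)) (+-comm (g i) (f i ∸ g i)) ⟩
  (f i ∸ g i + g i) + (F∸G + G)           ≡⟨ interchange (f i ∸ g i) (g i) F∸G G ⟩
  (f i ∸ g i + F∸G) + (g i + G)           ∎
  where
  open ≤-Reasoning
  F∸G = sum (map (λ i → f i ∸ g i) is)
  G   = sum (map g is)

rowCount : ℕ → List Box → ℕ
rowCount i B = length (filter (λ x → row x ≟ i) B)

rowCount+rows>≡rows≥ : ∀ r B → rowCount r B + length (filter (λ x → suc r ≤? row x) B) ≡ length (filter (λ x → r ≤? row x) B)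
rowCount+rows>≡rows≥ r []      = refl
rowCount+rows>≡rows≥ r (x ∷ B) with <-cmp r (row x)
... | tri< r<x r≢x _
  rewrite filter-reject (λ y → row y ≟ r) {x} {B} (r≢x ∘ sym)
        | filter-accept (λ y → suc r ≤? row y) {x} {B} r<x
        | filter-accept (λ y → r ≤? row y) {x} {B} (<⇒≤ r<x)
  = trans (+-suc (rowCount r B) _) (cong suc (rowCount+rows>≡rows≥ r B))
... | tri≈ _ r≡x _
  rewrite filter-accept (λ y → row y ≟ r) {x} {B} (sym r≡x)
        | filter-reject (λ y → suc r ≤? row y) {x} {B} (<-irrefl r≡x)
        | filter-accept (λ y → r ≤? row y) {x} {B} (≤-reflexive r≡x)
  = cong suc (rowCount+rows>≡rows≥ r B)
... | tri> _ r≢x x<r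
  rewrite filter-reject (λ y → row y ≟ r) {x} {B} (r≢x ∘ sym)
        | filter-reject (λ y → suc r ≤? row y) {x} {B} (<⇒≱ (m≤n⇒m≤1+n x<r))
        | filter-reject (λ y → r ≤? row y) {x} {B} (<⇒≱ x<r)
  = rowCount+rows>≡rows≥ r B

sum-rowCount≤ : ∀ B m r (g : ℕ → ℕ) → g ≗ (λ t → r + t) →
                sum (map (λ i → rowCount i B) (applyUpTo g m)) ℕ.≤ length (filter (λ x → r ≤? row x) B)
sum-rowCount≤ B zero    r g g≗ = z≤n
sum-rowCount≤ B (suc m) r g g≗ = begin
  rowCount (g 0) B + sum (map (λ i → rowCount i B) (applyUpTo (g ∘ suc) m))
    ≤⟨ +-mono-≤ (≤-reflexive (cong (λ i → rowCount i B) (trans (g≗ 0) (+-identityʳ r))))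
                (sum-rowCount≤ B m (suc r) (g ∘ suc) (λ t → trans (g≗ (suc t)) (+-suc r t))) ⟩
  rowCount r B + length (filter (λ x → suc r ≤? row x) B) ≡⟨ rowCount+rows>≡rows≥ r B ⟩
  length (filter (λ x → r ≤? row x) B)                    ∎
  where open ≤-Reasoning

φ≤length-bRim : ∀ b λs → φ b λs ℕ.≤ length (bRim b λs)
φ≤length-bRim b λs = m≤n+o⇒m∸n≤o (size λs) (size (partI b λs)) (begin
  size λs                                                    ≡⟨ cong sum (map-rowLen-rows λs) ⟨
  sum (map (rowLen λs) rows)                                 ≤⟨ sum-map≤sum-map-∸+sum-map (rowLen λs) c rows ⟩
  size (partI b λs) + sum (map c rows)                       ≡⟨ cong (λ is → size (partI b λs) + sum (map c is)) (map-upTo suc k) ⟩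
  size (partI b λs) + sum (map c (applyUpTo suc k))          ≤⟨ +-monoʳ-≤ (size (partI b λs))
                                                                  (≤-trans (sum-rowCount≤ B k 1 suc (λ _ → refl)) (length-filter _ B)) ⟩
  size (partI b λs) + length B                               ∎)
  where
  open ≤-Reasoning
  k    = length λs
  rows = map suc (upTo k)
  B    = bRim b λs
  c    = λ i → rowCount i B

size-addJ : ∀ δ n μs → length μs ≡ suc n → size (addJ δ μs) ≡ size μs + n + δ
size-addJ δ zero    (m ∷ [])      _  = solve 2 (λ m δ → (m :+ δ) :+ con 0 := ((m :+ con 0) :+ con 0) :+ δ) refl m δ
size-addJ δ (suc n) (m ∷ m′ ∷ ms) eq = begin
  suc m + size (addJ δ (m′ ∷ ms))   ≡⟨ cong (_+_ (suc m)) (size-addJ δ n (m′ ∷ ms) (suc-injective eq)) ⟩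
  suc m + (size (m′ ∷ ms) + n + δ)  ≡⟨ solve 4 (λ m s n δ → (con 1 :+ m) :+ ((s :+ n) :+ δ) := ((m :+ s) :+ (con 1 :+ n)) :+ δ)
                                           refl m (size (m′ ∷ ms)) n δ ⟩
  m + size (m′ ∷ ms) + suc n + δ    ∎
  where open ≡-Reasoning

length-partI : ∀ b λs → length (partI b λs) ≡ length λs
length-partI b λs = trans (length-map _ (map suc (upTo k))) (trans (length-map suc (upTo k)) (length-upTo k))
  where k = length λs

m≤1+n⇒m≤n+[b∣m] : ∀ {b m n} → m ℕ.≤ suc n → b ∣ suc n → m ℕ.≤ n + (if does (b ∣? m) then 1 else 0)
m≤1+n⇒m≤n+[b∣m] {b} {m} {n} m≤1+n b∣1+n with b ∣? m
... | yes _   = subst (m ℕ.≤_) (+-comm 1 n) m≤1+n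
... | no  b∤m = subst (m ℕ.≤_) (sym (+-identityʳ n)) (s≤s⁻¹ (≤∧≢⇒< m≤1+n λ { refl → b∤m b∣1+n }))

+m-+n≤+o : ∀ {m n o} → m ℕ.≤ n + o → + m - + n ≤ + o
+m-+n≤+o {m} {n} m≤n+o rewrite ℤ.m-n≡m⊖n m n with ≤-total n m
... | inj₁ n≤m rewrite ℤ.⊖-≥ n≤m = +≤+ (m≤n+o⇒m∸n≤o m n m≤n+o)
... | inj₂ m≤n rewrite ℤ.⊖-≤ m≤n = ℤ.neg-≤-pos

lemma5p2 : (b : ℕ) → 0 < b → (l : ℕ) (ls : List ℕ) →
    IsPartition (l ∷ ls) → IsRegular b (l ∷ ls) →
    b ∣ (l + length (l ∷ ls) ∸ 1) →
    (+ size (l ∷ ls)) - (+ size (partJ b (l ∷ ls))) ≤ + (l ∸ 1)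
lemma5p2 b _ zero    ls record { positive = () ∷ _ } _ _
lemma5p2 b _ (suc l) ls partition _ b∣H = +m-+n≤+o (begin
  size λs                    ≤⟨ m≤n+m∸n (size λs) I ⟩
  I + φ b λs                 ≤⟨ +-monoʳ-≤ I (m≤1+n⇒m≤n+[b∣m] φ≤H (subst (b ∣_) (+-suc l n) b∣H)) ⟩
  I + (l + n + δ)            ≡⟨ solve 4 (λ I l n δ → I :+ ((l :+ n) :+ δ) := ((I :+ n) :+ δ) :+ l) refl I l n δ ⟩
  I + n + δ + l              ≡⟨ cong (_+ l) (size-addJ δ n (partI b λs) (length-partI b λs)) ⟨
  size (partJ b λs) + l      ∎)
  where
  open ≤-Reasoning
  λs = suc l ∷ ls
  n  = length ls
  I  = size (partI b λs)
  δ  = if does (b ∣? φ b λs) then 1 else 0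
  φ≤H : φ b λs ℕ.≤ suc (l + n)
  φ≤H = ≤-trans (φ≤length-bRim b λs)
          (≤-trans (length-bRimFrom≤ (length λs) b λs 1) (length-rim≤ (suc l) ls (IsPartition.decreasing partition)))
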